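{- Let $T=(V,E)$ be a tree and let $\mathcal F$ be a family of paths in $T$ that separates $V$. If $e=xy\in E$ is such that $x$ and $y$ both have degree $2$ in $T$, then $x$ or $y$ is an end (extreme vertex) of some path in $\mathcal F$.
   Context: A path in $T$ is a sequence of distinct vertices $v_0\dots v_l$ ($l\ge0$) with consecutive ones adjacent; $v_0$ and $v_l$ are its ends. For a vertex $v$, $\mathcal F(v)$ is the set of paths in $\mathcal F$ containing $v$; $\mathcal F$ separates $V$ if $\mathcal F(u)\neq\mathcal F(v)$ for all distinct $u,v\in V$. -}

module Defs where

open import Data.Nat using (ℕ; _≤_)
open import Data.Fin using (Fin)
open import Data.Bool using (Bool; T)
open import Data.List using (List; []; _∷_; _∷ʳ_; length; filterᵇ; allFin)
open import Data.List.Membership.Propositional using (_∈_)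
open import Data.List.Relation.Unary.Unique.Propositional using (Unique)
open import Data.List.Relation.Unary.Linked using (Linked)
open import Data.Product using (Σ; ∃; _×_)
open import Data.Sum using (_⊎_)
open import Relation.Nullary using (¬_)
open import Relation.Binary.PropositionalEquality using (_≡_; _≢_)

record Graph (n : ℕ) : Set where
  field
    adj   : Fin n → Fin n → Bool
    sym   : ∀ u v → T (adj u v) → T (adj v u)
    irrefl : ∀ v → ¬ T (adj v v)

module _ {n : ℕ} (G : Graph n) where
  open Graph G

  Adj : Fin n → Fin n → Set
  Adj u v = T (adj u v)

  degree : Fin n → ℕ
  degree x = length (filterᵇ (adj x) (allFin n))

  record Path : Set where
    constructor mkPath
    field
      verts    : List (Fin n)
      nonempty : verts ≢ []
      distinct : Unique verts
      linked   : Linked Adj verts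

  _∈P_ : Fin n → Path → Set
  v ∈P P = v ∈ Path.verts P

  IsEnd : Fin n → Path → Set
  IsEnd v P = (∃ λ xs → Path.verts P ≡ v ∷ xs) ⊎ (∃ λ xs → Path.verts P ≡ xs ∷ʳ v)

  PathBetween : Fin n → Fin n → Path → Set
  PathBetween u v P = (∃ λ xs → Path.verts P ≡ u ∷ xs) × (∃ λ xs → Path.verts P ≡ xs ∷ʳ v)

  Connected : Set
  Connected = ∀ u v → Σ Path (PathBetween u v)

  IsCycle : Path → Set
  IsCycle P = 3 ≤ length (Path.verts P) ×
              (∃ λ v₀ → ∃ λ vₗ → PathBetween v₀ vₗ P × Adj vₗ v₀)

  Acyclic : Set
  Acyclic = ∀ P → ¬ IsCycle P

  IsTree : Set
  IsTree = Connected × Acyclic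

  -- 𝓕(u) ≠ 𝓕(v) : the sets of paths of 𝓕 through u and through v differ
  Separates : List Path → Set
  Separates 𝓕 = ∀ u v → u ≢ v →
    ¬ (∀ P → P ∈ 𝓕 → (u ∈P P → v ∈P P) × (v ∈P P → u ∈P P))

-- A vertex of degree at most 2 lying on a path of 𝓕 but not being one of its ends
-- has both of its neighbours on that path. So if x and y are adjacent vertices of
-- degree 2 and neither is an end of a path P, then P contains both or neither of
-- x and y. If this held for every P ∈ 𝓕, then 𝓕(x) = 𝓕(y), contradicting separation.
module Submission where

open import Defs
open import Data.Nat using (ℕ; _≤_; _<_; s≤s; z≤n)
open import Data.Nat.Properties using (m≤n⇒m≤1+n; ≤-reflexive; ≤-trans; <-irrefl)
open import Data.Fin using (Fin)
open import Data.Fin.Properties using (_≟_)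
open import Data.List using (List; []; _∷_; _∷ʳ_; length; filterᵇ; allFin)
open import Data.List.Membership.Propositional using (_∈_; find)
open import Data.List.Membership.Propositional.Properties using (∈-filter⁺; ∈-allFin)
import Data.List.Membership.DecPropositional as DecMembership
open import Data.List.Relation.Unary.Any using (Any; here; there)
open import Data.List.Relation.Unary.All using (All; []; _∷_)
import Data.List.Relation.Unary.All as All
open import Data.List.Relation.Unary.AllPairs using (_∷_)
open import Data.List.Relation.Unary.Linked using (Linked; _∷_)
import Data.List.Relation.Unary.Linked as Linked
open import Data.List.Relation.Unary.Unique.Propositional using (Unique)
open import Data.Product using (Σ; ∃; ∃₂; _×_; _,_)
open import Data.Sum using (_⊎_; inj₁; inj₂)
open import Data.Empty using (⊥; ⊥-elim)
open import Relation.Nullary using (¬_; yes; no; contradiction)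
open import Relation.Nullary.Decidable using (T?)
open import Relation.Binary.PropositionalEquality using (_≡_; refl; cong; _≢_)

module _ {A : Set} where

  ∈⇒0<length : ∀ {a : A} {xs} → a ∈ xs → 0 < length xs
  ∈⇒0<length (here _)  = s≤s z≤n
  ∈⇒0<length (there _) = s≤s z≤n

  distinct-∈⇒2≤length : ∀ {a b : A} {xs} → a ∈ xs → b ∈ xs → a ≢ b → 2 ≤ length xs
  distinct-∈⇒2≤length (here refl) (here refl) a≢b = contradiction refl a≢b
  distinct-∈⇒2≤length (here refl) (there b∈) _   = s≤s (∈⇒0<length b∈)
  distinct-∈⇒2≤length (there a∈) _ _             = s≤s (∈⇒0<length a∈)

  distinct-∈⇒3≤length : ∀ {a b c : A} {xs} → a ∈ xs → b ∈ xs → c ∈ xs →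
                        a ≢ b → a ≢ c → b ≢ c → 3 ≤ length xs
  distinct-∈⇒3≤length (here refl) (here refl) _ a≢b _ _ = contradiction refl a≢b
  distinct-∈⇒3≤length (here refl) (there _) (here refl) _ a≢c _ = contradiction refl a≢c
  distinct-∈⇒3≤length (here refl) (there b∈) (there c∈) _ _ b≢c =
    s≤s (distinct-∈⇒2≤length b∈ c∈ b≢c)
  distinct-∈⇒3≤length (there _) (here refl) (here refl) _ _ b≢c = contradiction refl b≢c
  distinct-∈⇒3≤length (there a∈) (here refl) (there c∈) _ a≢c _ =
    s≤s (distinct-∈⇒2≤length a∈ c∈ a≢c)
  distinct-∈⇒3≤length (there a∈) (there b∈) (here refl) a≢b _ _ =
    s≤s (distinct-∈⇒2≤length a∈ b∈ a≢b)
  distinct-∈⇒3≤length (there a∈) (there b∈) (there c∈) a≢b a≢c b≢c =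
    m≤n⇒m≤1+n (distinct-∈⇒3≤length a∈ b∈ c∈ a≢b a≢c b≢c)

  any⊎all : {P Q : A → Set} → (∀ a → P a ⊎ Q a) → ∀ xs → Any P xs ⊎ All Q xs
  any⊎all P⊎Q [] = inj₂ []
  any⊎all P⊎Q (a ∷ xs) with P⊎Q a | any⊎all P⊎Q xs
  ... | inj₁ pa | _         = inj₁ (here pa)
  ... | inj₂ _  | inj₁ any  = inj₁ (there any)
  ... | inj₂ qa | inj₂ all  = inj₂ (qa ∷ all)

  EndOf : A → List A → Set
  EndOf a vs = (∃ λ xs → vs ≡ a ∷ xs) ⊎ (∃ λ xs → vs ≡ xs ∷ʳ a)

  InteriorOf : (A → A → Set) → A → List A → Set
  InteriorOf R a vs = ∃₂ λ p s → p ∈ vs × s ∈ vs × R p a × R a s × p ≢ s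

  end⊎interior : ∀ {R : A → A → Set} {a vs} → Linked R vs → Unique vs → a ∈ vs →
                 EndOf a vs ⊎ InteriorOf R a vs
  end⊎interior {vs = v ∷ vs} _ _ (here refl) = inj₁ (inj₁ (vs , refl))
  end⊎interior {vs = v ∷ vs} linked (_ ∷ unique) (there a∈vs)
    with end⊎interior (Linked.tail linked) unique a∈vs
  end⊎interior {vs = v ∷ _ ∷ []} _ _ _ | inj₁ (inj₁ ([] , refl)) =
    inj₁ (inj₂ (v ∷ [] , refl))
  end⊎interior {vs = v ∷ _ ∷ s ∷ _} (vRa ∷ aRs ∷ _) ((_ ∷ v≢s ∷ _) ∷ _) _
    | inj₁ (inj₁ (s ∷ _ , refl)) =
    inj₂ (v , s , here refl , there (there (here refl)) , vRa , aRs , v≢s)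
  ... | inj₁ (inj₂ (xs , eq)) = inj₁ (inj₂ (v ∷ xs , cong (v ∷_) eq))
  ... | inj₂ (p , s , p∈ , s∈ , pRa , aRs , p≢s) =
    inj₂ (p , s , there p∈ , there s∈ , pRa , aRs , p≢s)

module _ {n : ℕ} (G : Graph n) where
  open Graph G renaming (sym to adj-sym)
  open DecMembership (_≟_ {n}) using (_∈?_)

  SameMembership : Fin n → Fin n → Path G → Set
  SameMembership x y P = (_∈P_ G x P → _∈P_ G y P) × (_∈P_ G y P → _∈P_ G x P)

  degree≤2⇒¬three-neighbours : ∀ {x a b c} → degree G x ≤ 2 →
    Adj G x a → Adj G x b → Adj G x c → a ≢ b → a ≢ c → b ≢ c → ⊥
  degree≤2⇒¬three-neighbours {x} deg xa xb xc a≢b a≢c b≢c =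
    <-irrefl refl (≤-trans (distinct-∈⇒3≤length (neighbour xa) (neighbour xb) (neighbour xc)
                                                 a≢b a≢c b≢c)
                           deg)
    where
      neighbour : ∀ {v} → Adj G x v → v ∈ filterᵇ (adj x) (allFin n)
      neighbour {v} = ∈-filter⁺ (λ u → T? (adj x u)) (∈-allFin v)

  end-of-path-avoiding-neighbour : ∀ {x y} (P : Path G) → degree G x ≤ 2 → Adj G x y →
    _∈P_ G x P → ¬ _∈P_ G y P → IsEnd G x P
  end-of-path-avoiding-neighbour P deg xy x∈P y∉P
    with end⊎interior (Path.linked P) (Path.distinct P) x∈P
  ... | inj₁ end = end
  ... | inj₂ (p , s , p∈P , s∈P , px , xs , p≢s) =
    ⊥-elim (degree≤2⇒¬three-neighbours deg (adj-sym _ _ px) xs xy p≢s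
              (λ { refl → y∉P p∈P }) (λ { refl → y∉P s∈P }))

  end⊎end⊎same-membership : ∀ {x y} → degree G x ≤ 2 → degree G y ≤ 2 → Adj G x y →
    (P : Path G) → (IsEnd G x P ⊎ IsEnd G y P) ⊎ SameMembership x y P
  end⊎end⊎same-membership {x} {y} dx dy xy P with x ∈? Path.verts P | y ∈? Path.verts P
  ... | yes x∈P | yes y∈P = inj₂ ((λ _ → y∈P) , (λ _ → x∈P))
  ... | no x∉P  | no y∉P  = inj₂ ((λ x∈P → contradiction x∈P x∉P) , (λ y∈P → contradiction y∈P y∉P))
  ... | yes x∈P | no y∉P  = inj₁ (inj₁ (end-of-path-avoiding-neighbour P dx xy x∈P y∉P))
  ... | no x∉P  | yes y∈P = inj₁ (inj₂ (end-of-path-avoiding-neighbour P dy (adj-sym _ _ xy) y∈P x∉P))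

lemma6p2 : {n : ℕ} (T : Graph n) → IsTree T → (𝓕 : List (Path T)) → Separates T 𝓕 →
    (x y : Fin n) → Adj T x y → degree T x ≡ 2 → degree T y ≡ 2 →
    Σ (Path T) (λ P → P ∈ 𝓕 × (IsEnd T x P ⊎ IsEnd T y P))
lemma6p2 G _ 𝓕 separates x y xy dx dy
  with any⊎all (end⊎end⊎same-membership G (≤-reflexive dx) (≤-reflexive dy) xy) 𝓕
... | inj₁ some-end = find some-end
... | inj₂ all-same = contradiction (λ P → All.lookup all-same) (separates x y x≢y)
  where
    x≢y : x ≢ y
    x≢y refl = Graph.irrefl G x xy
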